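{- Let $\mathcal{L}=(D,A,B,\mathcal{P})$ be a partially linked web. If $\mathcal{T}$ is a set of pairwise strongly disjoint augmenting trails of $\mathcal{L}$, then there is a partial linkage $\mathcal{Q}$ of $(D,A,B)$ with $\mathsf{in}(\mathcal{Q})=\mathsf{in}(\mathcal{P})\cup\mathsf{in}(\mathcal{T})$ and $\mathsf{ter}(\mathcal{Q})=\mathsf{ter}(\mathcal{P})\cup\mathsf{ter}(\mathcal{T})$.
   Context: A digraph is a pair $D=(V,E)$ with $E\subseteq (V\times V)\setminus\{vv\}$ and $uv\in E\Rightarrow vu\notin E$; it may be infinite. A web $(D,A,B)$ has $A,B\subseteq V$, no edges into $A$, no edges out of $B$. A path is a trivial vertex or a finite directed path without repeated vertices; an $XY$-path is trivial at a vertex of $X\cap Y$ or nontrivial from $X$ to $Y$ with interior outside $X\cup Y$. A partial linkage is a set of pairwise vertex-disjoint $AB$-paths; $(D,A,B,\mathcal{P})$ with $\mathcal{P}$ a partial linkage is a partially linked web. $\mathsf{in},\mathsf{ter}$ give initial/terminal vertices (of a trail or set of trails). Put $\widehat{A}=A\setminus\mathsf{in}(\mathcal{P})$, $\widehat{B}=B\setminus\mathsf{ter}(\mathcal{P})$; let $D^*=(V,E^*)$ be $D$ with the edges of $E(\mathcal{P})$ reversed. A trail is a single vertex or a finite sequence $(v_0v_1,\dots,v_{n-1}v_n)$ of pairwise distinct edges. Alternating trails of $\mathcal{L}$: the trivial trails $v\in\widehat{A}$, and nontrivial $T=(v_0v_1,\dots,v_{n-1}v_n)$ with (1) $T$ a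 trail in $D^*$; (2) $v_0\in\widehat{A}$; (3) if $v_i=v_j$, $i<j$, then $v_i\in V(\mathcal{P})$ and $j\ne n$; (4) if $v_i\in V(\mathcal{P})$, $v_{i-1}v_i\in E^*\cap E$ and $i<n$ then $v_iv_{i+1}\in E^*\setminus E$. Augmenting: terminating in $\widehat{B}$. Two alternating trails $R,T$ are strongly disjoint if they are vertex-disjoint and there is no $P\in\mathcal{P}$ meeting both $R$ and $T$. -}

module Defs where

open import Level using (0ℓ)
open import Data.Nat using (ℕ; zero; suc; _<_; _>_)
open import Data.Fin using (Fin; toℕ; inject₁; fromℕ) renaming (suc to fsuc; zero to fzero)
open import Data.Vec using (Vec; lookup)
open import Data.Vec.Membership.Propositional using (_∈_)
open import Data.Product using (Σ; ∃; _×_; _,_; proj₁; proj₂)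
open import Data.Sum using (_⊎_)
open import Data.Empty using (⊥)
open import Relation.Nullary using (¬_)
open import Relation.Binary.PropositionalEquality using (_≡_; _≢_)

-- Digraphs (possibly infinite): no loops, no pair of opposite edges.
-- An edge is identified with its pair of endpoints; E u v is "uv ∈ E".

record Digraph : Set₁ where
  field
    V      : Set
    E      : V → V → Set
    irrefl : ∀ v → ¬ E v v
    asym   : ∀ u v → E u v → ¬ E v u

Subset : Set → Set₁
Subset X = X → Set

-- Finite nonempty vertex sequences (v₀ , … , vₙ), used both for paths
-- and for trails.  The number n is the number of edges.

Seq : Set → Set
Seq X = Σ ℕ (λ n → Vec X (suc n))

module _ {X : Set} where

  len : Seq X → ℕ
  len = proj₁

  vtx : (s : Seq X) → Fin (suc (len s)) → X
  vtx (n , vs) i = lookup vs i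

  first : Seq X → X
  first s = vtx s fzero

  final : Seq X → X
  final s = vtx s (fromℕ (len s))

  src : (s : Seq X) → Fin (len s) → X
  src s k = vtx s (inject₁ k)

  tgt : (s : Seq X) → Fin (len s) → X
  tgt s k = vtx s (fsuc k)

  _onSeq_ : X → Seq X → Set
  v onSeq (n , vs) = v ∈ vs

  EdgeOf : Seq X → X → X → Set
  EdgeOf s u v = Σ (Fin (len s)) (λ k → src s k ≡ u × tgt s k ≡ v)

  inₛ : Subset (Seq X) → Subset X
  inₛ 𝒮 v = Σ (Seq X) (λ s → 𝒮 s × first s ≡ v)

  terₛ : Subset (Seq X) → Subset X
  terₛ 𝒮 v = Σ (Seq X) (λ s → 𝒮 s × final s ≡ v)

module _ (D : Digraph) where
  open Digraph D

  IsWeb : Subset V → Subset V → Set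
  IsWeb A B = (∀ u v → E u v → ¬ A v) × (∀ u v → E u v → ¬ B u)

  IsPath : Seq V → Set
  IsPath s = (∀ k → E (src s k) (tgt s k))
           × (∀ i j → vtx s i ≡ vtx s j → i ≡ j)

  IsXYPath : Subset V → Subset V → Seq V → Set
  IsXYPath X Y s = IsPath s × X (first s) × Y (final s)
                 × (∀ i → toℕ i > 0 → toℕ i < len s →
                       ¬ X (vtx s i) × ¬ Y (vtx s i))

  IsPartialLinkage : Subset V → Subset V → Subset (Seq V) → Set
  IsPartialLinkage A B 𝒫 =
      (∀ p → 𝒫 p → IsXYPath A B p)
    × (∀ p q → 𝒫 p → 𝒫 q → p ≢ q → ∀ v → v onSeq p → ¬ (v onSeq q))

  module _ (A B : Subset V) (𝒫 : Subset (Seq V)) where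

    Â : Subset V
    Â v = A v × ¬ inₛ 𝒫 v

    B̂ : Subset V
    B̂ v = B v × ¬ terₛ 𝒫 v

    V𝒫 : Subset V
    V𝒫 v = Σ (Seq V) (λ p → 𝒫 p × v onSeq p)

    E𝒫 : V → V → Set
    E𝒫 u v = Σ (Seq V) (λ p → 𝒫 p × EdgeOf p u v)

    E* : V → V → Set
    E* u v = (E u v × ¬ E𝒫 u v) ⊎ E𝒫 v u

    IsAlternatingTrail : Seq V → Set
    IsAlternatingTrail t =
        (∀ k → E* (src t k) (tgt t k))
      × (∀ k l → k ≢ l → ¬ (src t k ≡ src t l × tgt t k ≡ tgt t l))
      × Â (first t)
      × (∀ i j → toℕ i < toℕ j → vtx t i ≡ vtx t j →
            V𝒫 (vtx t i) × toℕ j ≢ len t)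
        -- (4) for 0 < i < n: v_i ∈ V(𝒫) and v_{i-1}v_i ∈ E* ∩ E
        --     imply v_i v_{i+1} ∈ E* ∖ E   (edges k and l = k+1)
      × (∀ k l → toℕ l ≡ suc (toℕ k) → V𝒫 (tgt t k) →
            E* (src t k) (tgt t k) × E (src t k) (tgt t k) →
            E* (src t l) (tgt t l) × ¬ E (src t l) (tgt t l))

    IsAugmentingTrail : Seq V → Set
    IsAugmentingTrail t = IsAlternatingTrail t × B̂ (final t)

    StronglyDisjoint : Seq V → Seq V → Set
    StronglyDisjoint r t =
        (∀ v → v onSeq r → ¬ (v onSeq t))
      × (∀ p → 𝒫 p → ¬ ((Σ V λ v → v onSeq p × v onSeq r)
                       × (Σ V λ v → v onSeq p × v onSeq t)))

_≐_ : {X : Set} → Subset X → Subset X → Set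
P ≐ Q = ∀ x → (P x → Q x) × (Q x → P x)

_∪_ : {X : Set} → Subset X → Subset X → Subset X
(P ∪ Q) x = P x ⊎ Q x

{-# OPTIONS --safe #-}
module Submission where

-- The new linkage is formed by the maximal walks of a relation F: the edges of the paths in 𝒫
-- that no trail traverses backwards, together with the edges that the trails traverse
-- forwards.  The alternation conditions and the strong disjointness of the trails show that
-- every vertex has at most one F-predecessor and at most one F-successor, that F-sources lie
-- in in(𝒫) ∪ in(𝒯) and that F-sinks lie in ter(𝒫) ∪ ter(𝒯).  So the maximal F-walks starting
-- in in(𝒫) ∪ in(𝒯) are pairwise disjoint AB-paths ending exactly in ter(𝒫) ∪ ter(𝒯).  They
-- are finite since they do not repeat vertices and never leave the union of one trail with
-- the paths of 𝒫 it meets (or a single path of 𝒫 meeting no trail).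

open import Defs
open import Level using (0ℓ)
open import Axiom.ExcludedMiddle using (ExcludedMiddle)
open import Data.Nat using (ℕ; zero; suc; _<_; _≤_; _∸_; _≟_; z≤n; s≤s)
open import Data.Nat.Properties
  using (<⇒≤; ≤-refl; <-irrefl; <-trans; <-≤-trans; <-cmp; ≤∧≢⇒<; n<1+n; suc-injective;
         m<1+n⇒m<n∨m≡n; m≤n⇒m<n∨m≡n; m∸n≤m; +-∸-assoc; n∸n≡0)
open import Data.Fin using (Fin; toℕ; fromℕ<; inject₁; fromℕ) renaming (suc to fsuc; zero to fzero)
open import Data.Fin.Properties
  using (pigeonhole; toℕ<n; toℕ≤pred[n]; toℕ-fromℕ<; toℕ-inject₁; toℕ-fromℕ; toℕ-injective; fromℕ<-injective)
open import Data.Vec using (lookup; tabulate; toList; _∷_; [])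
open import Data.Vec.Properties using (lookup∘tabulate; tabulate∘lookup; tabulate-cong)
open import Data.Vec.Relation.Unary.Any using (here; there)
open import Data.Vec.Membership.Propositional.Properties using (∈-toList⁺)
import Data.List as List
open import Data.List using (List; []; _++_; length; concatMap)
open import Data.List.Membership.Propositional using (_∈_)
open import Data.List.Membership.Propositional.Properties using (∈-++⁺ˡ; ∈-++⁺ʳ; ∈-map⁺; ∈-concat⁺′)
import Data.List.Relation.Unary.Any as Any
open import Data.List.Relation.Unary.Any.Properties using (lookup-index)
open import Data.Product using (Σ; ∃; ∃₂; _×_; _,_; proj₁; proj₂)
open import Data.Sum using (_⊎_; inj₁; inj₂)
import Data.Sum as Sum
open import Data.Empty using (⊥-elim)
open import Function using (_∘_; flip)
open import Relation.Nullary using (¬_; yes; no)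
open import Relation.Binary using (tri<; tri≈; tri>)
open import Relation.Binary.PropositionalEquality

∈-pigeonhole : {X : Set} (L : List X) {N : ℕ} (g : ℕ → X) → length L ≤ N →
               (∀ i → i ≤ N → g i ∈ L) → ∃₂ λ i j → i < j × j ≤ N × g i ≡ g j
∈-pigeonhole L {N} g L≤N g∈L with pigeonhole (s≤s L≤N) position
  where
    position : Fin (suc N) → Fin (length L)
    position i = Any.index (g∈L (toℕ i) (toℕ≤pred[n] i))
... | i , j , i<j , same-position = toℕ i , toℕ j , i<j , toℕ≤pred[n] j , (begin
    g (toℕ i)                                  ≡⟨ lookup-index (g∈L (toℕ i) (toℕ≤pred[n] i)) ⟩
    List.lookup L (Any.index (g∈L (toℕ i) _))  ≡⟨ cong (List.lookup L) same-position ⟩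
    List.lookup L (Any.index (g∈L (toℕ j) _))  ≡⟨ lookup-index (g∈L (toℕ j) (toℕ≤pred[n] j)) ⟨
    g (toℕ j)                                  ∎)
  where open ≡-Reasoning

module _ {X : Set} (R : X → X → Set) where

  Walk : (ℕ → X) → ℕ → Set
  Walk g m = ∀ k → k < m → R (g k) (g (suc k))

  HasIn : X → Set
  HasIn v = ∃ λ u → R u v

  HasOut : X → Set
  HasOut u = ∃ λ v → R u v

  LeftUnique : Set
  LeftUnique = ∀ {u u′ v} → R u v → R u′ v → u ≡ u′

  RightUnique : Set
  RightUnique = ∀ {u v v′} → R u v → R u v′ → v ≡ v′

  walk-snoc : ∀ {g m} → Walk g m → R (g m) (g (suc m)) → Walk g (suc m)
  walk-snoc walk last k k<1+m with m<1+n⇒m<n∨m≡n k<1+m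
  ... | inj₁ k<m  = walk k k<m
  ... | inj₂ refl = last

  -- Walking backwards from a common vertex, both walks must reach a source at the same time.
  walks-from-sources-align : LeftUnique → ∀ {g g′ m m′} → Walk g m → Walk g′ m′ →
    ¬ HasIn (g 0) → ¬ HasIn (g′ 0) →
    ∀ {i j} → i ≤ m → j ≤ m′ → g i ≡ g′ j → i ≡ j × g 0 ≡ g′ 0
  walks-from-sources-align uniq walk walk′ src src′ {zero}  {zero}  _ _ same = refl , same
  walks-from-sources-align uniq {g′ = g′} walk walk′ src src′ {zero}  {suc j} _ j<m′ same =
    ⊥-elim (src (g′ j , subst (R (g′ j)) (sym same) (walk′ j j<m′)))
  walks-from-sources-align uniq {g = g} walk walk′ src src′ {suc i} {zero}  i<m _ same =
    ⊥-elim (src′ (g i , subst (R (g i)) same (walk i i<m)))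
  walks-from-sources-align uniq {g′ = g′} walk walk′ src src′ {suc i} {suc j} i<m j<m′ same
    with walks-from-sources-align uniq walk walk′ src src′ (<⇒≤ i<m) (<⇒≤ j<m′)
           (uniq (walk i i<m) (subst (R (g′ j)) (sym same) (walk′ j j<m′)))
  ... | refl , start = refl , start

  walk-from-source-injective : LeftUnique → ∀ {g m} → Walk g m → ¬ HasIn (g 0) →
    ∀ {i j} → i ≤ m → j ≤ m → g i ≡ g j → i ≡ j
  walk-from-source-injective uniq walk src i≤m j≤m same =
    proj₁ (walks-from-sources-align uniq walk walk src src i≤m j≤m same)

  walks-agree : RightUnique → ∀ {g g′ m m′} → Walk g m → Walk g′ m′ → g 0 ≡ g′ 0 →
    ∀ {k} → k ≤ m → k ≤ m′ → g k ≡ g′ k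
  walks-agree uniq walk walk′ start {zero}  _ _ = start
  walks-agree uniq {g′ = g′} walk walk′ start {suc k} k<m k<m′ =
    uniq (walk k k<m)
         (subst (λ x → R x (g′ (suc k))) (sym (walks-agree uniq walk walk′ start (<⇒≤ k<m) (<⇒≤ k<m′)))
                (walk′ k k<m′))

  maximal-walks-same-length : RightUnique → ∀ {g g′ m m′} → Walk g m → Walk g′ m′ → g 0 ≡ g′ 0 →
    ¬ HasOut (g m) → ¬ HasOut (g′ m′) → m ≡ m′
  maximal-walks-same-length uniq {g} {g′} {m} {m′} walk walk′ start stuck stuck′ with <-cmp m m′
  ... | tri≈ _ m≡m′ _ = m≡m′
  ... | tri< m<m′ _ _ = ⊥-elim (stuck (g′ (suc m) , subst (λ x → R x (g′ (suc m)))
          (sym (walks-agree uniq walk walk′ start ≤-refl (<⇒≤ m<m′))) (walk′ m m<m′)))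
  ... | tri> _ _ m′<m = ⊥-elim (stuck′ (g (suc m′) , subst (λ x → R x (g (suc m′)))
          (walks-agree uniq walk walk′ start (<⇒≤ m′<m) ≤-refl) (walk m′ m′<m)))

  module _ (em : ExcludedMiddle 0ℓ) where

    private
      next : X → X
      next u with em {HasOut u}
      ... | yes (v , _) = v
      ... | no _        = u

      next-step : ∀ {u} → HasOut u → R u (next u)
      next-step {u} out with em {HasOut u}
      ... | yes (_ , step) = step
      ... | no stuck       = ⊥-elim (stuck out)

      iterate : X → ℕ → X
      iterate s zero    = s
      iterate s (suc k) = next (iterate s k)

      walk-or-stuck : ∀ s k → Walk (iterate s) k ⊎ ∃ λ m → Walk (iterate s) m × ¬ HasOut (iterate s m)
      walk-or-stuck s zero    = inj₁ λ _ ()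
      walk-or-stuck s (suc k) with walk-or-stuck s k
      ... | inj₂ stuck = inj₂ stuck
      ... | inj₁ walk with em {HasOut (iterate s k)}
      ...   | yes out  = inj₁ (walk-snoc walk (next-step out))
      ...   | no stuck = inj₂ (k , walk , stuck)

      iterate-closed : (P : X → Set) → (∀ {u v} → P u → R u v → P v) → ∀ {s} → P s → ∀ k → P (iterate s k)
      iterate-closed P closed Ps zero    = Ps
      iterate-closed P closed {s} Ps (suc k) with em {HasOut (iterate s k)}
      ... | yes (_ , step) = closed (iterate-closed P closed Ps k) step
      ... | no _           = iterate-closed P closed Ps k

    -- The walk is injective, so inside a finite region it cannot go on forever.
    maximal-walk-exists : LeftUnique → (P : X → Set) (L : List X) → (∀ {u} → P u → u ∈ L) →
      (∀ {u v} → P u → R u v → P v) → ∀ {s} → P s → ¬ HasIn s →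
      ∃₂ λ g m → g 0 ≡ s × Walk g m × ¬ HasOut (g m)
    maximal-walk-exists uniq P L covered closed {s} Ps src with walk-or-stuck s (length L)
    ... | inj₂ (m , walk , stuck) = iterate s , m , refl , walk , stuck
    ... | inj₁ walk with ∈-pigeonhole L (iterate s) ≤-refl
                           (λ i _ → covered (iterate-closed P closed Ps i))
    ...   | i , j , i<j , j≤ , same =
      ⊥-elim (<-irrefl (walk-from-source-injective uniq walk src (<⇒≤ (<-≤-trans i<j j≤)) j≤ same) i<j)

reverse-walk : {X : Set} {R : X → X → Set} {g : ℕ → X} {m : ℕ} →
               Walk (flip R) g m → Walk R (λ k → g (m ∸ k)) m
reverse-walk {R = R} {g} {m} walk k k<m =
  subst (λ j → R (g j) (g (m ∸ suc k))) (sym (+-∸-assoc 1 k<m))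
    (walk (m ∸ suc k) (subst (_≤ m) (+-∸-assoc 1 k<m) (m∸n≤m m k)))

walk-cong : {X : Set} {R : X → X → Set} {g g′ : ℕ → X} {m : ℕ} →
            (∀ k → k ≤ m → g k ≡ g′ k) → Walk R g m → Walk R g′ m
walk-cong {R = R} same walk k k< = subst₂ R (same k (<⇒≤ k<)) (same (suc k) k<) (walk k k<)

module _ {X : Set} where

  -- Past the end of the sequence, `at` repeats the final vertex.
  at : Seq X → ℕ → X
  at (zero  , v ∷ [])     _       = v
  at (suc n , v ∷ _)      zero    = v
  at (suc n , _ ∷ vs)     (suc k) = at (n , vs) k

  vtx≡at : (s : Seq X) (i : Fin (suc (len s))) → vtx s i ≡ at s (toℕ i)
  vtx≡at (zero  , v ∷ [])  fzero    = refl
  vtx≡at (suc n , v ∷ vs)  fzero    = refl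
  vtx≡at (suc n , v ∷ vs)  (fsuc i) = vtx≡at (n , vs) i

  vtx-fromℕ< : (s : Seq X) {k : ℕ} (k≤ : k ≤ len s) → vtx s (fromℕ< (s≤s k≤)) ≡ at s k
  vtx-fromℕ< s k≤ = trans (vtx≡at s _) (cong (at s) (toℕ-fromℕ< (s≤s k≤)))

  first≡at : (s : Seq X) → first s ≡ at s 0
  first≡at s = vtx≡at s fzero

  final≡at : (s : Seq X) → final s ≡ at s (len s)
  final≡at s = trans (vtx≡at s (fromℕ (len s))) (cong (at s) (toℕ-fromℕ (len s)))

  src≡at : (s : Seq X) (k : Fin (len s)) → src s k ≡ at s (toℕ k)
  src≡at s k = trans (vtx≡at s (inject₁ k)) (cong (at s) (toℕ-inject₁ k))

  tgt≡at : (s : Seq X) (k : Fin (len s)) → tgt s k ≡ at s (suc (toℕ k))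
  tgt≡at s k = vtx≡at s (fsuc k)

  src-fromℕ< : (s : Seq X) {k : ℕ} (k< : k < len s) → src s (fromℕ< k<) ≡ at s k
  src-fromℕ< s k< = trans (src≡at s _) (cong (at s) (toℕ-fromℕ< k<))

  tgt-fromℕ< : (s : Seq X) {k : ℕ} (k< : k < len s) → tgt s (fromℕ< k<) ≡ at s (suc k)
  tgt-fromℕ< s k< = trans (tgt≡at s _) (cong (at s ∘ suc) (toℕ-fromℕ< k<))

  at-onSeq : (s : Seq X) {k : ℕ} → k ≤ len s → at s k onSeq s
  at-onSeq (zero  , v ∷ [])  z≤n       = here refl
  at-onSeq (suc n , v ∷ vs)  z≤n       = here refl
  at-onSeq (suc n , v ∷ vs)  (s≤s k≤)  = there (at-onSeq (n , vs) k≤)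

  first-onSeq : (s : Seq X) → first s onSeq s
  first-onSeq s = subst (_onSeq s) (sym (first≡at s)) (at-onSeq s z≤n)

  final-onSeq : (s : Seq X) → final s onSeq s
  final-onSeq s = subst (_onSeq s) (sym (final≡at s)) (at-onSeq s ≤-refl)

  onSeq⇒at : (s : Seq X) {v : X} → v onSeq s → ∃ λ k → k ≤ len s × at s k ≡ v
  onSeq⇒at (zero  , v ∷ [])  (here refl) = 0 , z≤n , refl
  onSeq⇒at (suc n , v ∷ vs)  (here refl) = 0 , z≤n , refl
  onSeq⇒at (suc n , v ∷ vs)  (there v∈)  with onSeq⇒at (n , vs) v∈
  ... | k , k≤ , eq = suc k , s≤s k≤ , eq

  at-ext : (s s′ : Seq X) → len s ≡ len s′ → (∀ k → k ≤ len s → at s k ≡ at s′ k) → s ≡ s′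
  at-ext (n , vs) (.n , vs′) refl same = cong (n ,_) (begin
      vs                     ≡⟨ tabulate∘lookup vs ⟨
      tabulate (lookup vs)   ≡⟨ tabulate-cong pointwise ⟩
      tabulate (lookup vs′)  ≡⟨ tabulate∘lookup vs′ ⟩
      vs′                    ∎)
    where
      open ≡-Reasoning
      pointwise : ∀ i → lookup vs i ≡ lookup vs′ i
      pointwise i = begin
        lookup vs i           ≡⟨ vtx≡at (n , vs) i ⟩
        at (n , vs) (toℕ i)   ≡⟨ same (toℕ i) (toℕ≤pred[n] i) ⟩
        at (n , vs′) (toℕ i)  ≡⟨ vtx≡at (n , vs′) i ⟨
        lookup vs′ i          ∎

  fromFun : ℕ → (ℕ → X) → Seq X
  fromFun m g = m , tabulate (λ i → g (toℕ i))

  at-fromFun : ∀ m g {k} → k ≤ m → at (fromFun m g) k ≡ g k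
  at-fromFun m g {k} k≤ = begin
      at (fromFun m g) k                   ≡⟨ vtx-fromℕ< (fromFun m g) k≤ ⟨
      vtx (fromFun m g) (fromℕ< (s≤s k≤))  ≡⟨ lookup∘tabulate (λ i → g (toℕ i)) (fromℕ< (s≤s k≤)) ⟩
      g (toℕ (fromℕ< (s≤s k≤)))            ≡⟨ cong g (toℕ-fromℕ< (s≤s k≤)) ⟩
      g k                                  ∎
    where open ≡-Reasoning

  record Step (𝒮 : Subset (Seq X)) (u v : X) : Set where
    constructor step
    field
      seq      : Seq X
      member   : 𝒮 seq
      index    : ℕ
      index<   : index < len seq
      at-index : at seq index ≡ u
      at-next  : at seq (suc index) ≡ v

  EdgeOf⇒Step : ∀ {𝒮 u v} → Σ (Seq X) (λ s → 𝒮 s × EdgeOf s u v) → Step 𝒮 u v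
  EdgeOf⇒Step (s , s∈ , k , refl , refl) = step s s∈ (toℕ k) (toℕ<n k) (sym (src≡at s k)) (sym (tgt≡at s k))

  step-endpoints-onSeq : ∀ {𝒮 u v} (st : Step 𝒮 u v) → u onSeq Step.seq st × v onSeq Step.seq st
  step-endpoints-onSeq (step s _ k k< refl refl) = at-onSeq s (<⇒≤ k<) , at-onSeq s k<

  OnSome : Subset (Seq X) → Subset X
  OnSome 𝒮 v = ∃ λ s → 𝒮 s × v onSeq s

  Step-source-OnSome : ∀ {𝒮 u v} → Step 𝒮 u v → OnSome 𝒮 u
  Step-source-OnSome st = Step.seq st , Step.member st , proj₁ (step-endpoints-onSeq st)

  Step-target-OnSome : ∀ {𝒮 u v} → Step 𝒮 u v → OnSome 𝒮 v
  Step-target-OnSome st = Step.seq st , Step.member st , proj₂ (step-endpoints-onSeq st)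

  inₛ⇒OnSome : ∀ {𝒮 v} → inₛ 𝒮 v → OnSome 𝒮 v
  inₛ⇒OnSome (s , s∈ , refl) = s , s∈ , first-onSeq s

  terₛ⇒OnSome : ∀ {𝒮 v} → terₛ 𝒮 v → OnSome 𝒮 v
  terₛ⇒OnSome (s , s∈ , refl) = s , s∈ , final-onSeq s

  OnSome⇒first-or-step-in : ∀ {𝒮 v} → OnSome 𝒮 v → inₛ 𝒮 v ⊎ ∃ λ u → Step 𝒮 u v
  OnSome⇒first-or-step-in (s , s∈ , v∈) with onSeq⇒at s v∈
  ... | zero  , _   , refl = inj₁ (s , s∈ , first≡at s)
  ... | suc k , k<  , refl = inj₂ (at s k , step s s∈ k k< refl refl)

  OnSome⇒final-or-step-out : ∀ {𝒮 v} → OnSome 𝒮 v → terₛ 𝒮 v ⊎ ∃ λ w → Step 𝒮 v w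
  OnSome⇒final-or-step-out (s , s∈ , v∈) with onSeq⇒at s v∈
  ... | k , k≤ , refl with m≤n⇒m<n∨m≡n k≤
  ...   | inj₁ k<  = inj₂ (at s (suc k) , step s s∈ k k< refl refl)
  ...   | inj₂ refl = inj₁ (s , s∈ , final≡at s)

  edges⇒walk : (R : X → X → Set) (s : Seq X) → (∀ k → R (src s k) (tgt s k)) → Walk R (at s) (len s)
  edges⇒walk R s edges k k< =
    subst₂ R (src-fromℕ< s k<) (tgt-fromℕ< s k<) (edges (fromℕ< k<))

  walk⇒edges : (R : X → X → Set) (s : Seq X) → Walk R (at s) (len s) → ∀ k → R (src s k) (tgt s k)
  walk⇒edges R s walk k = subst₂ R (sym (src≡at s k)) (sym (tgt≡at s k)) (walk (toℕ k) (toℕ<n k))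

module Linkage (em : ExcludedMiddle 0ℓ) (D : Digraph) {A B : Subset (Digraph.V D)} (web : IsWeb D A B)
               {𝒫 : Subset (Seq (Digraph.V D))} (linkage : IsPartialLinkage D A B 𝒫) where

  open Digraph D

  PathEdge : V → V → Set
  PathEdge = Step 𝒫

  VP : Subset V
  VP = V𝒫 D A B 𝒫

  A-no-in : ∀ {u v} → A v → ¬ E u v
  A-no-in Av uv = proj₁ web _ _ uv Av

  B-no-out : ∀ {u v} → B u → ¬ E u v
  B-no-out Bu uv = proj₂ web _ _ uv Bu

  path-walk : ∀ {p} → 𝒫 p → Walk E (at p) (len p)
  path-walk {p} p∈ = edges⇒walk E p (proj₁ (proj₁ (proj₁ linkage p p∈)))

  path-unique : ∀ {p p′ v} → 𝒫 p → 𝒫 p′ → v onSeq p → v onSeq p′ → p ≡ p′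
  path-unique {p} {p′} p∈ p′∈ v∈p v∈p′ with em {p ≡ p′}
  ... | yes p≡p′ = p≡p′
  ... | no p≢p′ = ⊥-elim (proj₂ linkage p p′ p∈ p′∈ p≢p′ _ v∈p v∈p′)

  path-injective : ∀ {p} → 𝒫 p → ∀ {i j} → i ≤ len p → j ≤ len p → at p i ≡ at p j → i ≡ j
  path-injective {p} p∈ {i} {j} i≤ j≤ same = fromℕ<-injective i j (s≤s i≤) (s≤s j≤)
    (proj₂ (proj₁ (proj₁ linkage p p∈)) _ _ (trans (vtx-fromℕ< p i≤) (trans same (sym (vtx-fromℕ< p j≤)))))

  PathEdge⇒E : ∀ {u v} → PathEdge u v → E u v
  PathEdge⇒E (step p p∈ k k< refl refl) = path-walk p∈ k k<

  PathEdge-leftUnique : LeftUnique PathEdge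
  PathEdge-leftUnique (step p p∈ k k< refl refl) (step p′ p′∈ k′ k′< refl same)
    with path-unique p∈ p′∈ (at-onSeq p k<) (subst (_onSeq p′) same (at-onSeq p′ k′<))
  ... | refl with path-injective p∈ k< k′< (sym same)
  ... | refl = refl

  PathEdge-rightUnique : RightUnique PathEdge
  PathEdge-rightUnique (step p p∈ k k< refl refl) (step p′ p′∈ k′ k′< same refl)
    with path-unique p∈ p′∈ (at-onSeq p (<⇒≤ k<)) (subst (_onSeq p′) same (at-onSeq p′ (<⇒≤ k′<)))
  ... | refl with path-injective p∈ (<⇒≤ k<) (<⇒≤ k′<) (sym same)
  ... | refl = refl

  first-A : ∀ {v} → inₛ 𝒫 v → A v
  first-A (p , p∈ , refl) = proj₁ (proj₂ (proj₁ linkage p p∈))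

  final-B : ∀ {v} → terₛ 𝒫 v → B v
  final-B (p , p∈ , refl) = proj₁ (proj₂ (proj₂ (proj₁ linkage p p∈)))

  VP-A⇒first : ∀ {v} → VP v → A v → inₛ 𝒫 v
  VP-A⇒first vp Av with OnSome⇒first-or-step-in vp
  ... | inj₁ first    = first
  ... | inj₂ (_ , pe) = ⊥-elim (A-no-in Av (PathEdge⇒E pe))

  VP-B⇒final : ∀ {v} → VP v → B v → terₛ 𝒫 v
  VP-B⇒final vp Bv with OnSome⇒final-or-step-out vp
  ... | inj₁ final    = final
  ... | inj₂ (_ , pe) = ⊥-elim (B-no-out Bv (PathEdge⇒E pe))

module Augmentation (em : ExcludedMiddle 0ℓ) (D : Digraph) {A B : Subset (Digraph.V D)} (web : IsWeb D A B)
  {𝒫 : Subset (Seq (Digraph.V D))} (linkage : IsPartialLinkage D A B 𝒫)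
  {𝒯 : Subset (Seq (Digraph.V D))} (augmenting : ∀ t → 𝒯 t → IsAugmentingTrail D A B 𝒫 t)
  (disjoint : ∀ r t → 𝒯 r → 𝒯 t → r ≢ t → StronglyDisjoint D A B 𝒫 r t) where

  open Digraph D
  open Linkage em D web linkage

  TrailStep : V → V → Set
  TrailStep = Step 𝒯

  trail-unique : ∀ {t t′ v} → 𝒯 t → 𝒯 t′ → v onSeq t → v onSeq t′ → t ≡ t′
  trail-unique {t} {t′} t∈ t′∈ v∈t v∈t′ with em {t ≡ t′}
  ... | yes t≡t′ = t≡t′
  ... | no t≢t′ = ⊥-elim (proj₁ (disjoint t t′ t∈ t′∈ t≢t′) _ v∈t v∈t′)

  path-meets-one-trail : ∀ {p t t′ x y} → 𝒫 p → 𝒯 t → 𝒯 t′ →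
    x onSeq p → x onSeq t → y onSeq p → y onSeq t′ → t ≡ t′
  path-meets-one-trail {p} {t} {t′} p∈ t∈ t′∈ x∈p x∈t y∈p y∈t′ with em {t ≡ t′}
  ... | yes t≡t′ = t≡t′
  ... | no t≢t′ = ⊥-elim (proj₂ (disjoint t t′ t∈ t′∈ t≢t′) p p∈ ((_ , x∈p , x∈t) , (_ , y∈p , y∈t′)))

  E*⇒E-or-PathEdge : ∀ {u v} → E* D A B 𝒫 u v → E u v ⊎ PathEdge v u
  E*⇒E-or-PathEdge (inj₁ (uv , _)) = inj₁ uv
  E*⇒E-or-PathEdge (inj₂ pe)       = inj₂ (EdgeOf⇒Step pe)

  module Trail {t : Seq V} (t∈ : 𝒯 t) where

    private
      g : ℕ → V
      g = at t
      n : ℕ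
      n = len t
      alternating : IsAlternatingTrail D A B 𝒫 t
      alternating = proj₁ (augmenting t t∈)

    step-kind : ∀ {k} → k < n → E (g k) (g (suc k)) ⊎ PathEdge (g (suc k)) (g k)
    step-kind {k} k< = E*⇒E-or-PathEdge (edges⇒walk (E* D A B 𝒫) t (proj₁ alternating) k k<)

    steps-distinct : ∀ {k l} → k < n → l < n → g k ≡ g l → g (suc k) ≡ g (suc l) → k ≡ l
    steps-distinct {k} {l} k< l< same-src same-tgt with k ≟ l
    ... | yes k≡l = k≡l
    ... | no k≢l = ⊥-elim (proj₁ (proj₂ alternating) (fromℕ< k<) (fromℕ< l<)
            (k≢l ∘ fromℕ<-injective k l k< l<)
            ( trans (src-fromℕ< t k<) (trans same-src (sym (src-fromℕ< t l<)))
            , trans (tgt-fromℕ< t k<) (trans same-tgt (sym (tgt-fromℕ< t l<)))))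

    private
      repeated-later : ∀ {i j} → i < j → j ≤ n → g i ≡ g j → VP (g i) × i < n × j < n
      repeated-later {i} {j} i<j j≤ same =
        subst VP (vtx-fromℕ< t i≤) (proj₁ condition) , <-≤-trans i<j j≤ ,
        ≤∧≢⇒< j≤ (proj₂ condition ∘ trans (toℕ-fromℕ< (s≤s j≤)))
        where
          i≤ : i ≤ n
          i≤ = <⇒≤ (<-≤-trans i<j j≤)
          condition : VP (vtx t (fromℕ< (s≤s i≤))) × toℕ (fromℕ< (s≤s j≤)) ≢ n
          condition = proj₁ (proj₂ (proj₂ (proj₂ alternating))) (fromℕ< (s≤s i≤)) (fromℕ< (s≤s j≤))
            (subst₂ _<_ (sym (toℕ-fromℕ< (s≤s i≤))) (sym (toℕ-fromℕ< (s≤s j≤))) i<j)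
            (trans (vtx-fromℕ< t i≤) (trans same (sym (vtx-fromℕ< t j≤))))

    repeated-vertex : ∀ {i j v} → i ≢ j → i ≤ n → j ≤ n → g i ≡ v → g j ≡ v → VP v × i < n × j < n
    repeated-vertex {i} {j} i≢j i≤ j≤ refl same with <-cmp i j
    ... | tri≈ _ i≡j _ = ⊥-elim (i≢j i≡j)
    ... | tri< i<j _ _ = repeated-later i<j j≤ (sym same)
    ... | tri> _ _ j<i with repeated-later j<i i≤ same
    ...   | vp , j<n , i<n = subst VP same vp , i<n , j<n

    forward-then-backward : ∀ {k v} → suc k < n → g (suc k) ≡ v → VP v → E (g k) v →
                            PathEdge (g (suc (suc k))) v
    forward-then-backward {k} sk< refl vp forward with step-kind sk<
    ... | inj₂ backward = backward
    ... | inj₁ forward′ =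
      ⊥-elim (proj₂ condition (subst₂ E (sym (src-fromℕ< t sk<)) (sym (tgt-fromℕ< t sk<)) forward′))
      where
        k< : k < n
        k< = <-trans (n<1+n k) sk<
        condition : E* D A B 𝒫 (src t (fromℕ< sk<)) (tgt t (fromℕ< sk<)) × ¬ E (src t (fromℕ< sk<)) (tgt t (fromℕ< sk<))
        condition = proj₂ (proj₂ (proj₂ (proj₂ alternating))) (fromℕ< k<) (fromℕ< sk<)
          (trans (toℕ-fromℕ< sk<) (cong suc (sym (toℕ-fromℕ< k<))))
          (subst VP (sym (tgt-fromℕ< t k<)) vp)
          (proj₁ alternating _ , subst₂ E (sym (src-fromℕ< t k<)) (sym (tgt-fromℕ< t k<)) forward)

    start-Â : Â D A B 𝒫 (g 0)
    start-Â = subst (Â D A B 𝒫) (first≡at t) (proj₁ (proj₂ (proj₂ alternating)))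

    end-B̂ : B̂ D A B 𝒫 (g n)
    end-B̂ = subst (B̂ D A B 𝒫) (final≡at t) (proj₂ (augmenting t t∈))

    start-not-VP : ¬ VP (g 0)
    start-not-VP vp = proj₂ start-Â (VP-A⇒first vp (proj₁ start-Â))

    end-not-VP : ¬ VP (g n)
    end-not-VP vp = proj₂ end-B̂ (VP-B⇒final vp (proj₁ end-B̂))

    backward-before-forward : ∀ {k v} → suc k < n → g (suc k) ≡ v → VP v → E v (g (suc (suc k))) →
                              PathEdge v (g k)
    backward-before-forward {k} sk< refl vp forward with step-kind (<-trans (n<1+n k) sk<)
    ... | inj₂ backward  = backward
    ... | inj₁ forward′ = ⊥-elim (asym _ _ forward (PathEdge⇒E (forward-then-backward sk< refl vp forward′)))

    backward-steps-into-coincide : ∀ {a b v} → a < n → b < n → g (suc a) ≡ v → g (suc b) ≡ v →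
      PathEdge v (g a) → PathEdge v (g b) → a ≡ b
    backward-steps-into-coincide a< b< refl same back back′ =
      steps-distinct a< b< (PathEdge-rightUnique back back′) (sym same)

    backward-steps-out-coincide : ∀ {a b v} → a < n → b < n → g a ≡ v → g b ≡ v →
      PathEdge (g (suc a)) v → PathEdge (g (suc b)) v → a ≡ b
    backward-steps-out-coincide a< b< refl same back back′ =
      steps-distinct a< b< (sym same) (PathEdge-leftUnique back back′)

    forward-steps-into-coincide : ∀ {k l v} → k < n → l < n → g (suc k) ≡ v → g (suc l) ≡ v →
      E (g k) v → E (g l) v → k ≡ l
    forward-steps-into-coincide {k} {l} k< l< refl same forward forward′ with k ≟ l
    ... | yes k≡l = k≡l
    ... | no k≢l with repeated-vertex (k≢l ∘ suc-injective) k< l< refl same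
    ...   | vp , sk< , sl< = suc-injective (backward-steps-out-coincide sk< sl< refl same
              (forward-then-backward sk< refl vp forward) (forward-then-backward sl< same vp forward′))

    forward-steps-out-coincide : ∀ {k l v} → k < n → l < n → g k ≡ v → g l ≡ v →
      E v (g (suc k)) → E v (g (suc l)) → k ≡ l
    forward-steps-out-coincide {zero}  {zero}  _  _  _    _    _ _ = refl
    forward-steps-out-coincide {zero}  {suc _} _  l< refl same _ _ =
      ⊥-elim (start-not-VP (proj₁ (repeated-vertex (λ ()) z≤n (<⇒≤ l<) refl same)))
    forward-steps-out-coincide {suc _} {zero}  k< _  same refl _ _ =
      ⊥-elim (start-not-VP (proj₁ (repeated-vertex (λ ()) z≤n (<⇒≤ k<) refl same)))
    forward-steps-out-coincide {suc a} {suc b} k< l< refl same forward forward′ with a ≟ b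
    ... | yes a≡b = cong suc a≡b
    ... | no a≢b with repeated-vertex (a≢b ∘ suc-injective) (<⇒≤ k<) (<⇒≤ l<) refl same
    ...   | vp , _ , _ = cong suc (backward-steps-into-coincide (<⇒≤ k<) (<⇒≤ l<) refl same
              (backward-before-forward k< refl vp forward) (backward-before-forward l< same vp forward′))

  -- A trail step is forward iff it is an edge of D: a reversed 𝒫-edge is not, as D has no opposite edges.
  ForwardStep : V → V → Set
  ForwardStep u v = TrailStep u v × E u v

  ForwardStep-leftUnique : LeftUnique ForwardStep
  ForwardStep-leftUnique (step t t∈ k k< refl refl , forward) (step t′ t′∈ k′ k′< refl same , forward′)
    with trail-unique t∈ t′∈ (at-onSeq t k<) (subst (_onSeq t′) same (at-onSeq t′ k′<))
  ... | refl with Trail.forward-steps-into-coincide t∈ k< k′< refl same forward forward′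
  ... | refl = refl

  ForwardStep-rightUnique : RightUnique ForwardStep
  ForwardStep-rightUnique (step t t∈ k k< refl refl , forward) (step t′ t′∈ k′ k′< same refl , forward′)
    with trail-unique t∈ t′∈ (at-onSeq t (<⇒≤ k<)) (subst (_onSeq t′) same (at-onSeq t′ (<⇒≤ k′<)))
  ... | refl with Trail.forward-steps-out-coincide t∈ k< k′< refl same forward forward′
  ... | refl = refl

  F : V → V → Set
  F u v = (PathEdge u v × ¬ TrailStep v u) ⊎ ForwardStep u v

  F⇒E : ∀ {u v} → F u v → E u v
  F⇒E (inj₁ (pe , _))     = PathEdge⇒E pe
  F⇒E (inj₂ (_ , forward)) = forward

  forward-into-PathEdge-target⇒reversed : ∀ {u u′ v} → PathEdge u v → ForwardStep u′ v → TrailStep v u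
  forward-into-PathEdge-target⇒reversed pe (step t t∈ k k< refl refl , forward) with suc k ≟ len t
  ... | yes sk≡n = ⊥-elim (Trail.end-not-VP t∈ (subst (VP ∘ at t) sk≡n (Step-target-OnSome pe)))
  ... | no sk≢n = step t t∈ (suc k) sk< refl
                    (PathEdge-leftUnique (Trail.forward-then-backward t∈ sk< refl (Step-target-OnSome pe) forward) pe)
    where
      sk< : suc k < len t
      sk< = ≤∧≢⇒< k< sk≢n

  forward-out-of-PathEdge-source⇒reversed : ∀ {v w w′} → PathEdge v w → ForwardStep v w′ → TrailStep w v
  forward-out-of-PathEdge-source⇒reversed pe (step t t∈ zero    k< refl refl , _) =
    ⊥-elim (Trail.start-not-VP t∈ (Step-source-OnSome pe))
  forward-out-of-PathEdge-source⇒reversed pe (step t t∈ (suc a) k< refl refl , forward) =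
    step t t∈ a (<⇒≤ k<)
      (PathEdge-rightUnique (Trail.backward-before-forward t∈ k< refl (Step-source-OnSome pe) forward) pe) refl

  F-leftUnique : LeftUnique F
  F-leftUnique (inj₁ (pe , _))    (inj₁ (pe′ , _))   = PathEdge-leftUnique pe pe′
  F-leftUnique (inj₁ (pe , kept)) (inj₂ fw)          = ⊥-elim (kept (forward-into-PathEdge-target⇒reversed pe fw))
  F-leftUnique (inj₂ fw)          (inj₁ (pe , kept)) = ⊥-elim (kept (forward-into-PathEdge-target⇒reversed pe fw))
  F-leftUnique (inj₂ fw)          (inj₂ fw′)         = ForwardStep-leftUnique fw fw′

  F-rightUnique : RightUnique F
  F-rightUnique (inj₁ (pe , _))    (inj₁ (pe′ , _))   = PathEdge-rightUnique pe pe′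
  F-rightUnique (inj₁ (pe , kept)) (inj₂ fw)          = ⊥-elim (kept (forward-out-of-PathEdge-source⇒reversed pe fw))
  F-rightUnique (inj₂ fw)          (inj₁ (pe , kept)) = ⊥-elim (kept (forward-out-of-PathEdge-source⇒reversed pe fw))
  F-rightUnique (inj₂ fw)          (inj₂ fw′)         = ForwardStep-rightUnique fw fw′

  Start : Subset V
  Start = inₛ 𝒫 ∪ inₛ 𝒯

  End : Subset V
  End = terₛ 𝒫 ∪ terₛ 𝒯

  Start⇒A : ∀ {v} → Start v → A v
  Start⇒A (inj₁ first)          = first-A first
  Start⇒A (inj₂ (t , t∈ , refl)) = subst A (sym (first≡at t)) (proj₁ (Trail.start-Â t∈))

  End⇒B : ∀ {v} → End v → B v
  End⇒B (inj₁ final)          = final-B final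
  End⇒B (inj₂ (t , t∈ , refl)) = subst B (sym (final≡at t)) (proj₁ (Trail.end-B̂ t∈))

  Start-no-F-in : ∀ {v} → Start v → ¬ HasIn F v
  Start-no-F-in start (_ , f) = A-no-in (Start⇒A start) (F⇒E f)

  End-no-F-out : ∀ {v} → End v → ¬ HasOut F v
  End-no-F-out end (_ , f) = B-no-out (End⇒B end) (F⇒E f)

  step-into-F-source-is-backward : ∀ {u v} → ¬ HasIn F v → TrailStep u v → PathEdge v u
  step-into-F-source-is-backward noin st@(step t t∈ k k< refl refl) with Trail.step-kind t∈ k<
  ... | inj₁ forward  = ⊥-elim (noin (_ , inj₂ (st , forward)))
  ... | inj₂ backward = backward

  step-out-of-F-sink-is-backward : ∀ {v w} → ¬ HasOut F v → TrailStep v w → PathEdge w v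
  step-out-of-F-sink-is-backward noout st@(step t t∈ k k< refl refl) with Trail.step-kind t∈ k<
  ... | inj₁ forward  = ⊥-elim (noout (_ , inj₂ (st , forward)))
  ... | inj₂ backward = backward

  PathEdge-into-F-source-is-reversed : ∀ {u v} → ¬ HasIn F v → PathEdge u v → TrailStep v u
  PathEdge-into-F-source-is-reversed {u} {v} noin pe with em {TrailStep v u}
  ... | yes reversed = reversed
  ... | no kept      = ⊥-elim (noin (u , inj₁ (pe , kept)))

  PathEdge-out-of-F-sink-is-reversed : ∀ {v w} → ¬ HasOut F v → PathEdge v w → TrailStep w v
  PathEdge-out-of-F-sink-is-reversed {v} {w} noout pe with em {TrailStep w v}
  ... | yes reversed = reversed
  ... | no kept      = ⊥-elim (noout (w , inj₁ (pe , kept)))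

  F-source-is-Start : ∀ {v} → HasOut F v → ¬ HasIn F v → Start v
  F-source-is-Start {v} out noin with em {Start v}
  ... | yes start = start
  ... | no other  = ⊥-elim (no-out out)
    where
      entered-before : ∀ {t} (t∈ : 𝒯 t) {k} → k < len t → at t k ≡ v →
                       ∃ λ a → suc a ≡ k × PathEdge v (at t a)
      entered-before {t} t∈ {zero}  _  refl = ⊥-elim (other (inj₂ (t , t∈ , first≡at t)))
      entered-before {t} t∈ {suc a} k< refl =
        a , refl , step-into-F-source-is-backward noin (step t t∈ a (<⇒≤ k<) refl refl)

      reversed-out : VP v → ∃ λ x → PathEdge x v × TrailStep v x
      reversed-out vp with OnSome⇒first-or-step-in vp
      ... | inj₁ first    = ⊥-elim (other (inj₁ first))
      ... | inj₂ (x , pe) = x , pe , PathEdge-into-F-source-is-reversed noin pe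

      no-out : ¬ HasOut F v
      no-out (w , inj₁ (pe , kept)) with reversed-out (Step-source-OnSome pe)
      ... | _ , _ , step t t∈ k k< from _ with entered-before t∈ k< from
      ... | a , refl , pe′ = kept (step t t∈ a (<⇒≤ k<) (PathEdge-rightUnique pe′ pe) from)
      no-out (w , inj₂ (step t t∈ k k< refl refl , forward)) with entered-before t∈ k< refl
      ... | a , refl , pe with reversed-out (Step-source-OnSome pe)
      ... | x , pe′ , step t′ t′∈ k′ k′< from′ to′
            with trail-unique t∈ t′∈ (at-onSeq t (<⇒≤ k<)) (subst (_onSeq t′) from′ (at-onSeq t′ (<⇒≤ k′<)))
      ... | refl with entered-before t∈ k′< from′
      ... | b , refl , pe″ with Trail.backward-steps-into-coincide t∈ (<⇒≤ k<) (<⇒≤ k′<) refl from′ pe pe″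
      ... | refl = asym _ _ forward (PathEdge⇒E (subst (λ z → PathEdge z _) (sym to′) pe′))

  F-sink-is-End : ∀ {v} → HasIn F v → ¬ HasOut F v → End v
  F-sink-is-End {v} inn noout with em {End v}
  ... | yes end  = end
  ... | no other = ⊥-elim (no-in inn)
    where
      left-after : ∀ {t} (t∈ : 𝒯 t) {k} → k < len t → at t (suc k) ≡ v →
                   suc k < len t × PathEdge (at t (suc (suc k))) v
      left-after {t} t∈ {k} k< refl with suc k ≟ len t
      ... | yes refl = ⊥-elim (other (inj₂ (t , t∈ , final≡at t)))
      ... | no sk≢n  = sk< , step-out-of-F-sink-is-backward noout (step t t∈ (suc k) sk< refl refl)
        where
          sk< : suc k < len t
          sk< = ≤∧≢⇒< k< sk≢n

      reversed-in : VP v → ∃ λ y → PathEdge v y × TrailStep y v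
      reversed-in vp with OnSome⇒final-or-step-out vp
      ... | inj₁ final    = ⊥-elim (other (inj₁ final))
      ... | inj₂ (y , pe) = y , pe , PathEdge-out-of-F-sink-is-reversed noout pe

      no-in : ¬ HasIn F v
      no-in (u , inj₁ (pe , kept)) with reversed-in (Step-target-OnSome pe)
      ... | _ , _ , step t t∈ k k< _ into with left-after t∈ k< into
      ... | sk< , pe′ = kept (step t t∈ (suc k) sk< into (PathEdge-leftUnique pe′ pe))
      no-in (u , inj₂ (step t t∈ k k< refl refl , forward)) with left-after t∈ k< refl
      ... | sk< , pe with reversed-in (Step-target-OnSome pe)
      ... | y , pe′ , step t′ t′∈ k′ k′< from′ into′
            with trail-unique t∈ t′∈ (at-onSeq t k<) (subst (_onSeq t′) into′ (at-onSeq t′ k′<))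
      ... | refl with left-after t∈ k′< into′
      ... | sk′< , pe″ with Trail.backward-steps-out-coincide t∈ sk< sk′< refl into′ pe pe″
      ... | refl = asym _ _ forward (PathEdge⇒E (subst (PathEdge _) (sym from′) pe′))

  A-F-sink-on-trail-is-End : ∀ {v} → A v → ¬ HasOut F v → OnSome 𝒯 v → End v
  A-F-sink-on-trail-is-End Av noout on with OnSome⇒final-or-step-out on
  ... | inj₁ final    = inj₂ final
  ... | inj₂ (_ , st) = ⊥-elim (A-no-in Av (PathEdge⇒E (step-out-of-F-sink-is-backward noout st)))

  B-F-source-on-trail-is-Start : ∀ {v} → B v → ¬ HasIn F v → OnSome 𝒯 v → Start v
  B-F-source-on-trail-is-Start Bv noin on with OnSome⇒first-or-step-in on
  ... | inj₁ first    = inj₂ first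
  ... | inj₂ (_ , st) = ⊥-elim (B-no-out Bv (PathEdge⇒E (step-into-F-source-is-backward noin st)))

  Start-F-sink-is-End : ∀ {v} → Start v → ¬ HasOut F v → End v
  Start-F-sink-is-End start@(inj₂ first) noout = A-F-sink-on-trail-is-End (Start⇒A start) noout (inₛ⇒OnSome first)
  Start-F-sink-is-End start@(inj₁ first) noout with OnSome⇒final-or-step-out (inₛ⇒OnSome first)
  ... | inj₁ final    = inj₁ final
  ... | inj₂ (_ , pe) = A-F-sink-on-trail-is-End (Start⇒A start) noout
                          (Step-target-OnSome (PathEdge-out-of-F-sink-is-reversed noout pe))

  End-F-source-is-Start : ∀ {v} → End v → ¬ HasIn F v → Start v
  End-F-source-is-Start end@(inj₂ final) noin = B-F-source-on-trail-is-Start (End⇒B end) noin (terₛ⇒OnSome final)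
  End-F-source-is-Start end@(inj₁ final) noin with OnSome⇒first-or-step-in (terₛ⇒OnSome final)
  ... | inj₁ first    = inj₁ first
  ... | inj₂ (_ , pe) = B-F-source-on-trail-is-Start (End⇒B end) noin
                          (Step-source-OnSome (PathEdge-into-F-source-is-reversed noin pe))

  Piece : V → V → Set
  Piece y z = (∃ λ p → 𝒫 p × y onSeq p × z onSeq p) ⊎ (∃ λ t → 𝒯 t × y onSeq t × z onSeq t)

  F⇒Piece : ∀ {u v} → F u v → Piece u v
  F⇒Piece (inj₁ (pe , _)) = inj₁ (Step.seq pe , Step.member pe , step-endpoints-onSeq pe)
  F⇒Piece (inj₂ (st , _)) = inj₂ (Step.seq st , Step.member st , step-endpoints-onSeq st)

  Piece-sym : ∀ {u v} → Piece u v → Piece v u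
  Piece-sym (inj₁ (p , p∈ , u∈ , v∈)) = inj₁ (p , p∈ , v∈ , u∈)
  Piece-sym (inj₂ (t , t∈ , u∈ , v∈)) = inj₂ (t , t∈ , v∈ , u∈)

  record Region : Set₁ where
    field
      Member   : Subset V
      vertices : List V
      covered  : ∀ {u} → Member u → u ∈ vertices
      closed   : ∀ {y z} → Member y → Piece y z → Member z

  vertexList : Seq V → List V
  vertexList (_ , vs) = toList vs

  onSeq⇒∈vertexList : ∀ {v} (s : Seq V) → v onSeq s → v ∈ vertexList s
  onSeq⇒∈vertexList _ = ∈-toList⁺

  path-through : V → List V
  path-through x with em {VP x}
  ... | yes (p , _ , _) = vertexList p
  ... | no _            = []

  path-through-covers : ∀ {p x u} → 𝒫 p → x onSeq p → u onSeq p → u ∈ path-through x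
  path-through-covers {x = x} p∈ x∈ u∈ with em {VP x}
  ... | yes (p′ , p′∈ , x∈′) rewrite path-unique p∈ p′∈ x∈ x∈′ = onSeq⇒∈vertexList p′ u∈
  ... | no ¬vp = ⊥-elim (¬vp (_ , p∈ , x∈))

  MeetsTrail : Seq V → Set
  MeetsTrail p = ∃ λ t → 𝒯 t × ∃ λ x → x onSeq p × x onSeq t

  trail-region : ∀ {t} → 𝒯 t → Region
  trail-region {t} t∈ = record
    { Member   = Member
    ; vertices = vertexList t ++ concatMap path-through (vertexList t)
    ; covered  = covered
    ; closed   = closed
    }
    where
      Member : Subset V
      Member u = u onSeq t ⊎ ∃ λ p → 𝒫 p × (∃ λ x → x onSeq p × x onSeq t) × u onSeq p

      covered : ∀ {u} → Member u → u ∈ (vertexList t ++ concatMap path-through (vertexList t))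
      covered (inj₁ u∈) = ∈-++⁺ˡ (onSeq⇒∈vertexList t u∈)
      covered (inj₂ (p , p∈ , (x , x∈p , x∈t) , u∈)) = ∈-++⁺ʳ (vertexList t)
        (∈-concat⁺′ (path-through-covers p∈ x∈p u∈) (∈-map⁺ path-through (onSeq⇒∈vertexList t x∈t)))

      closed : ∀ {y z} → Member y → Piece y z → Member z
      closed (inj₁ y∈t) (inj₁ (p , p∈ , y∈p , z∈p)) = inj₂ (p , p∈ , (_ , y∈p , y∈t) , z∈p)
      closed (inj₁ y∈t) (inj₂ (t′ , t′∈ , y∈t′ , z∈t′)) rewrite trail-unique t∈ t′∈ y∈t y∈t′ = inj₁ z∈t′
      closed (inj₂ (p , p∈ , meet , y∈p)) (inj₁ (p′ , p′∈ , y∈p′ , z∈p′))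
        rewrite path-unique p∈ p′∈ y∈p y∈p′ = inj₂ (p′ , p′∈ , meet , z∈p′)
      closed (inj₂ (p , p∈ , (x , x∈p , x∈t) , y∈p)) (inj₂ (t′ , t′∈ , y∈t′ , z∈t′))
        rewrite path-meets-one-trail p∈ t∈ t′∈ x∈p x∈t y∈p y∈t′ = inj₁ z∈t′

  lonely-path-region : ∀ {p} → 𝒫 p → ¬ MeetsTrail p → Region
  lonely-path-region {p} p∈ lonely = record
    { Member   = _onSeq p
    ; vertices = vertexList p
    ; covered  = onSeq⇒∈vertexList p
    ; closed   = closed
    }
    where
      closed : ∀ {y z} → y onSeq p → Piece y z → z onSeq p
      closed y∈p (inj₁ (p′ , p′∈ , y∈p′ , z∈p′)) rewrite path-unique p∈ p′∈ y∈p y∈p′ = z∈p′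
      closed y∈p (inj₂ (t , t∈ , y∈t , _)) = ⊥-elim (lonely (t , t∈ , _ , y∈p , y∈t))

  OnPiece : Subset V
  OnPiece v = OnSome 𝒫 v ⊎ OnSome 𝒯 v

  region-containing : ∀ {v} → OnPiece v → Σ Region λ r → Region.Member r v
  region-containing (inj₂ (t , t∈ , v∈)) = trail-region t∈ , inj₁ v∈
  region-containing (inj₁ (p , p∈ , v∈)) with em {MeetsTrail p}
  ... | yes (t , t∈ , meet) = trail-region t∈ , inj₂ (p , p∈ , meet , v∈)
  ... | no lonely           = lonely-path-region p∈ lonely , v∈

  Start-OnPiece : ∀ {v} → Start v → OnPiece v
  Start-OnPiece = Sum.map inₛ⇒OnSome inₛ⇒OnSome

  End-OnPiece : ∀ {v} → End v → OnPiece v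
  End-OnPiece = Sum.map terₛ⇒OnSome terₛ⇒OnSome

  maximal-F-walk-from : ∀ {s} → OnPiece s → ¬ HasIn F s →
    ∃₂ λ g m → g 0 ≡ s × Walk F g m × ¬ HasOut F (g m)
  maximal-F-walk-from on noin with region-containing on
  ... | r , s∈r = maximal-walk-exists F em F-leftUnique (Region.Member r) (Region.vertices r)
                    (Region.covered r) (λ y∈ f → Region.closed r y∈ (F⇒Piece f)) s∈r noin

  maximal-reverse-F-walk-from : ∀ {s} → OnPiece s → ¬ HasOut F s →
    ∃₂ λ g m → g 0 ≡ s × Walk (flip F) g m × ¬ HasIn F (g m)
  maximal-reverse-F-walk-from on noout with region-containing on
  ... | r , s∈r = maximal-walk-exists (flip F) em F-rightUnique (Region.Member r) (Region.vertices r)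
                    (Region.covered r) (λ y∈ f → Region.closed r y∈ (Piece-sym (F⇒Piece f))) s∈r noout

  maximal-walk-from-Start-ends-in-End : ∀ {g m} → Walk F g m → Start (g 0) → ¬ HasOut F (g m) → End (g m)
  maximal-walk-from-Start-ends-in-End {m = zero}  _    start stuck = Start-F-sink-is-End start stuck
  maximal-walk-from-Start-ends-in-End {m = suc k} walk _     stuck = F-sink-is-End (_ , walk k ≤-refl) stuck

  maximal-walk-to-End-starts-in-Start : ∀ {g m} → Walk F g m → End (g m) → ¬ HasIn F (g 0) → Start (g 0)
  maximal-walk-to-End-starts-in-Start {m = zero}  _    end noin = End-F-source-is-Start end noin
  maximal-walk-to-End-starts-in-Start {m = suc k} walk _   noin = F-source-is-Start (_ , walk 0 (s≤s z≤n)) noin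

  𝒬 : Subset (Seq V)
  𝒬 q = Walk F (at q) (len q) × Start (at q 0) × End (at q (len q))

  fromFun∈𝒬 : ∀ {g m} → Walk F g m → Start (g 0) → End (g m) → 𝒬 (fromFun m g)
  fromFun∈𝒬 {g} {m} walk start end =
    walk-cong {R = F} (λ k k≤ → sym (at-fromFun m g k≤)) walk ,
    subst Start (sym (at-fromFun m g z≤n)) start ,
    subst End (sym (at-fromFun m g ≤-refl)) end

  Start⊆in𝒬 : ∀ {s} → Start s → inₛ 𝒬 s
  Start⊆in𝒬 start with maximal-F-walk-from (Start-OnPiece start) (Start-no-F-in start)
  ... | g , m , refl , walk , stuck =
    fromFun m g , fromFun∈𝒬 walk start (maximal-walk-from-Start-ends-in-End walk start stuck) ,
    trans (first≡at (fromFun m g)) (at-fromFun m g z≤n)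

  End⊆ter𝒬 : ∀ {b} → End b → terₛ 𝒬 b
  End⊆ter𝒬 end with maximal-reverse-F-walk-from (End-OnPiece end) (End-no-F-out end)
  ... | g , m , refl , walk , stuck =
    fromFun m h , fromFun∈𝒬 walk′ (maximal-walk-to-End-starts-in-Start walk′ end′ stuck) end′ ,
    trans (final≡at (fromFun m h)) (trans (at-fromFun m h ≤-refl) h-last)
    where
      h : ℕ → V
      h k = g (m ∸ k)
      walk′ : Walk F h m
      walk′ = reverse-walk {R = F} walk
      h-last : h m ≡ g 0
      h-last = cong g (n∸n≡0 m)
      end′ : End (h m)
      end′ = subst End (sym h-last) end

  in𝒬≐Start : inₛ 𝒬 ≐ Start
  in𝒬≐Start v = (λ { (q , (_ , start , _) , refl) → subst Start (sym (first≡at q)) start }) , Start⊆in𝒬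

  ter𝒬≐End : terₛ 𝒬 ≐ End
  ter𝒬≐End v = (λ { (q , (_ , _ , end) , refl) → subst End (sym (final≡at q)) end }) , End⊆ter𝒬

  𝒬-path : ∀ q → 𝒬 q → IsXYPath D A B q
  𝒬-path q (walk , start , end) =
    (walk⇒edges E q (λ k k< → F⇒E (walk k k<)) , injective) ,
    subst A (sym (first≡at q)) (Start⇒A start) ,
    subst B (sym (final≡at q)) (End⇒B end) ,
    λ i 0<i i< → subst (λ x → ¬ A x × ¬ B x) (sym (vtx≡at q i)) (interior 0<i i<)
    where
      injective : ∀ i j → vtx q i ≡ vtx q j → i ≡ j
      injective i j same = toℕ-injective (walk-from-source-injective F F-leftUnique walk (Start-no-F-in start)
        (toℕ≤pred[n] i) (toℕ≤pred[n] j) (trans (sym (vtx≡at q i)) (trans same (vtx≡at q j))))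

      interior : ∀ {k} → 0 < k → k < len q → ¬ A (at q k) × ¬ B (at q k)
      interior {suc a} _ k< = (λ Av → A-no-in Av (F⇒E (walk a (<⇒≤ k<))))
                            , (λ Bv → B-no-out Bv (F⇒E (walk (suc a) k<)))

  𝒬-unique : ∀ {q q′ v} → 𝒬 q → 𝒬 q′ → v onSeq q → v onSeq q′ → q ≡ q′
  𝒬-unique {q} {q′} (walk , start , end) (walk′ , start′ , end′) v∈q v∈q′
    with onSeq⇒at q v∈q | onSeq⇒at q′ v∈q′
  ... | i , i≤ , refl | j , j≤ , same =
    at-ext q q′ same-length λ k k≤ → walks-agree F F-rightUnique walk walk′ same-start k≤ (subst (k ≤_) same-length k≤)
    where
      same-start : at q 0 ≡ at q′ 0
      same-start = proj₂ (walks-from-sources-align F F-leftUnique walk walk′ (Start-no-F-in start) (Start-no-F-in start′)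
                     i≤ j≤ (sym same))
      same-length : len q ≡ len q′
      same-length = maximal-walks-same-length F F-rightUnique walk walk′ same-start (End-no-F-out end) (End-no-F-out end′)

  𝒬-linkage : IsPartialLinkage D A B 𝒬
  𝒬-linkage = 𝒬-path , λ q q′ q∈ q′∈ q≢q′ v v∈q v∈q′ → q≢q′ (𝒬-unique q∈ q′∈ v∈q v∈q′)

lemma3p3 : ExcludedMiddle 0ℓ →
    (D : Digraph) (A B : Subset (Digraph.V D)) (𝒫 : Subset (Seq (Digraph.V D))) →
    IsWeb D A B → IsPartialLinkage D A B 𝒫 →
    (𝒯 : Subset (Seq (Digraph.V D))) →
    (∀ t → 𝒯 t → IsAugmentingTrail D A B 𝒫 t) →
    (∀ r t → 𝒯 r → 𝒯 t → r ≢ t → StronglyDisjoint D A B 𝒫 r t) →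
    Σ (Subset (Seq (Digraph.V D))) (λ 𝒬 →
      IsPartialLinkage D A B 𝒬
      × (inₛ 𝒬 ≐ (inₛ 𝒫 ∪ inₛ 𝒯))
      × (terₛ 𝒬 ≐ (terₛ 𝒫 ∪ terₛ 𝒯)))
lemma3p3 em D A B 𝒫 web linkage 𝒯 augmenting disjoint = 𝒬 , 𝒬-linkage , in𝒬≐Start , ter𝒬≐End
  where open Augmentation em D web linkage augmenting disjoint
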